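{- Let $k\in\mathbb{N}$ with $\gcd(k,6)=3$, let $h$ be an integer coprime to $k$, and let $h'$ be an integer with $hh'\equiv -1\pmod{k}$ and $2\mid h'$. Then $$\frac{\omega_{2h,\frac{k}{3}}\omega_{2h,k}\omega_{h,k}}{\omega_{h,\frac{k}{3}}} =-e^{ - \frac{2\pi i}{36k} \left(-9k+9k^2+ h \left(-9+5k^2 \right) -2k^2h' \right)}\qquad\text{and}\qquad \frac{\omega_{h,\frac{k}{3}}\omega_{2h,k}\omega_{h,k}}{\omega_{2h,\frac{k}{3}}^3} =-e^{ - \frac{2\pi i}{18k} \left(3k^2+ h \left(9+k^2 \right) -k^2h' \right)}.$$
   Context: For coprime integers $h,K$ with $K\ge1$, let $h^\ast$ be any integer with $hh^\ast\equiv -1 \pmod K$ and set $$\omega_{h,K}:= \begin{cases} \left(\frac{ -K}{h} \right) e^{ -\pi i \left( \frac{1}{4}(2-hK-h)+\frac{1}{12}\left(K -\frac{1}{K} \right) \left(2h-h^\ast+h^2h^\ast\right)\right)}& \text{if } h \text{ is odd},\\ \left( \frac{ -h}{K} \right) e^{ -\pi i \left(\frac{1}{4}(K-1)+\frac{1}{12}\left(K-\frac{1}{K}\right) \left(2h-h^\ast+h^2h^\ast\right)\right) }& \text{if } K \text{ is odd},\end{cases}$$ with $\left(\frac{\cdot}{\cdot}\right)$ the Kronecker symbol (the standard eta-multiplier $e^{\pi i s(h,K)}$, $s$ the Dedekind sum; independent of the choice of $h^\ast$). -}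

module Defs where

open import Data.Nat as ℕ using (ℕ; zero; suc)
import Data.Nat.Divisibility as ℕD
open import Data.Nat.DivMod as ℕDM using ()
open import Data.Integer as ℤ using (ℤ; +_; -[1+_]; ∣_∣)
open import Data.Integer.DivMod using (_%ℕ_)
open import Data.Rational.Unnormalised as Q using (ℚᵘ; mkℚᵘ; _≃_)
open import Data.Bool using (Bool; true; false; if_then_else_)
open import Data.List using (List; upTo)
open import Data.Bool.ListAction using (any)
open import Data.Product using (∃)
open import Relation.Nullary.Decidable using (⌊_⌋)

-- Kronecker symbol (a/n), values in {-1,0,1} ⊆ ℤ, defined via the
-- prime factorisation of n, as usual:
--   (a/0)  = 1 if a = ±1, else 0
--   (a/-1) = -1 if a < 0, else 1,   (a/-n) = (a/-1)(a/n)
--   (a/n)  = ∏ (a/p)^e over n = ∏ p^e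
--   (a/2)  = 0 if a even, 1 if a ≡ ±1 (mod 8), -1 if a ≡ ±3 (mod 8)
--   (a/p)  = Legendre symbol for odd primes p

leastDivisor : ℕ → ℕ
leastDivisor m = go m 2
  where
  go : ℕ → ℕ → ℕ
  go zero    d = m
  go (suc f) d = if ⌊ d ℕD.∣? m ⌋ then d else go f (suc d)

divBy : ℕ → ℕ → ℕ
divBy m zero    = 0
divBy m (suc p) = m ℕDM./ suc p

legendre : ℤ → ℕ → ℤ
legendre a zero = ℤ.0ℤ
legendre a (suc q) =
  let p = suc q
      r = a %ℕ p
  in if ⌊ r ℕ.≟ 0 ⌋ then ℤ.0ℤ
     else if any (λ x → ⌊ ((x ℕ.* x) ℕDM.% p) ℕ.≟ r ⌋) (upTo p)
          then ℤ.1ℤ else ℤ.-1ℤ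

kronPrime : ℤ → ℕ → ℤ
kronPrime a p with p ℕ.≟ 2
... | Relation.Nullary.Decidable.yes _ =
  let r = a %ℕ 8 in
  if ⌊ (r ℕDM.% 2) ℕ.≟ 0 ⌋ then ℤ.0ℤ
  else if ⌊ r ℕ.≟ 1 ⌋ Data.Bool.∨ ⌊ r ℕ.≟ 7 ⌋ then ℤ.1ℤ else ℤ.-1ℤ
... | Relation.Nullary.Decidable.no _ = legendre a p

kronNat : ℤ → ℕ → ℤ
kronNat a n = go n n
  where
  go : ℕ → ℕ → ℤ
  go zero    m = ℤ.1ℤ
  go (suc f) m with m ℕ.≤? 1
  ... | Relation.Nullary.Decidable.yes _ = ℤ.1ℤ
  ... | Relation.Nullary.Decidable.no _ =
        let p = leastDivisor m in kronPrime a p ℤ.* go f (divBy m p)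

kronecker : ℤ → ℤ → ℤ
kronecker a (+ zero)    = if ⌊ ∣ a ∣ ℕ.≟ 1 ⌋ then ℤ.1ℤ else ℤ.0ℤ
kronecker a (+ suc n)   = kronNat a (suc n)
kronecker a -[1+ n ]    = signPart a ℤ.* kronNat a (suc n)
  where
  signPart : ℤ → ℤ
  signPart (+ _)    = ℤ.1ℤ
  signPart -[1+ _ ] = ℤ.-1ℤ

-- Roots of unity of the form e^{πi t}, t ∈ ℚ, represented by the
-- exponent t.  Multiplication = addition of exponents, and
-- e^{πi t} = e^{πi s}  iff  t - s ∈ 2ℤ.

_≈π_ : ℚᵘ → ℚᵘ → Set
t ≈π s = ∃ λ (m : ℤ) → (t Q.- s) ≃ mkℚᵘ (+ 2 ℤ.* m) 0

infix 4 _≈π_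

-- exponent of a sign ε ∈ {1,-1}:  ε = e^{πi (1-ε)/2}
signExp : ℤ → ℚᵘ
signExp ε = mkℚᵘ (ℤ.1ℤ ℤ.- ε) 1

ℤ→ℚ : ℤ → ℚᵘ
ℤ→ℚ z = mkℚᵘ z 0

KminusInvK : ℕ → ℚᵘ
KminusInvK zero    = Q.0ℚᵘ
KminusInvK (suc n) = ℤ→ℚ (+ suc n) Q.- mkℚᵘ ℤ.1ℤ n

-- ω_{h,K} = e^{πi · omegaExp h K h*}, where h* is a chosen integer
-- with h h* ≡ -1 (mod K).  If K is odd the second case of the
-- definition is used; otherwise (h necessarily odd) the first.
omegaExp : ℤ → ℕ → ℤ → ℚᵘ
omegaExp h K hs =
  let common = mkℚᵘ ℤ.1ℤ 11 Q.* KminusInvK K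
               Q.* ℤ→ℚ (+ 2 ℤ.* h ℤ.- hs ℤ.+ h ℤ.* h ℤ.* hs)
  in if ⌊ (K ℕDM.% 2) ℕ.≟ 1 ⌋
     then signExp (kronecker (ℤ.- h) (+ K))
          Q.- (mkℚᵘ (+ K ℤ.- ℤ.1ℤ) 3 Q.+ common)
     else signExp (kronecker (ℤ.- (+ K)) h)
          Q.- (mkℚᵘ (+ 2 ℤ.- h ℤ.* + K ℤ.- h) 3 Q.+ common)

IsStar : ℤ → ℕ → ℤ → Set
IsStar h K hs = (+ K) Data.Integer.Divisibility.∣ (h ℤ.* hs ℤ.+ ℤ.1ℤ)
  where import Data.Integer.Divisibility

{-# OPTIONS --safe #-}

-- For odd K the second case of the definition applies, so ω_{H,K} is the Kronecker
-- sign (−H/K) times e^{−πi φ} with φ = (K−1)/4 + (K − 1/K)(2H − H* + H²H*)/12.  Moving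
-- H* by tK moves φ by (K²−1)(H²−1)t/12, an even integer because 24 ∣ (K²−1)(H²−1) for
-- odd K prime to H; so every ω may be evaluated at H* = h′ (for h) and H* = h′/2 (for 2h).
-- With k = 3m, m odd, multiplicativity gives (−2h/k) = (−2h/3)(−2h/m) and
-- (−h/k) = (−h/3)(−h/m), where (−2h/3) = −(−h/3) = ±1; hence the Kronecker signs
-- contribute exactly the factor −1.  What remains is an identity of rationals: over the
-- common denominator 108m the phases differ from the claimed exponents by
-- 18h(5m²−1)(hh′+1) and 36h(m²+1)(hh′+1), even multiples of 108m since 3m ∣ hh′+1 and
-- 8 ∣ m²−1.

module Submission where

open import Defs
open import Level using (0ℓ)
open import Data.Bool using (true; false; if_then_else_)
open import Data.Empty using (⊥-elim)
open import Data.List using ([]; _∷_)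
open import Data.Nat as ℕ using (ℕ; zero; suc; _∸_; _≤_; _<_; s≤s; z≤n)
import Data.Nat.Properties as ℕP
import Data.Nat.Divisibility as ℕD
import Data.Nat.Coprimality as ℕC
open import Data.Nat.DivMod as ℕDM using (_%_; _/_)
open import Data.Nat.GCD using (gcd; gcd[m,n]∣m; gcd-greatest)
open import Data.Nat.Primality using (irreducible[2])
open import Data.Integer as ℤ using (ℤ; +_)
import Data.Integer.Properties as ℤP
open import Data.Integer.DivMod using (_%ℕ_; _/ℕ_; a≡a%ℕn+[a/ℕn]*n; n%ℕd<d)
open import Data.Integer.Coprimality as ℤC using (Coprime)
open import Data.Integer.Divisibility using (_∣_)
import Data.Integer.Divisibility.Signed as S
open import Data.Integer.Tactic.RingSolver using (solve; solve-∀)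
open import Data.Rational.Unnormalised as Q using (ℚᵘ; mkℚᵘ; _≃_; *≡*; ↥_; ↧_)
import Data.Rational.Unnormalised.Properties as ℚP
open import Data.Product using (∃; _×_; _,_; proj₁; proj₂)
open import Data.Sum using (_⊎_; inj₁; inj₂)
open import Function using (_∘_)
open import Relation.Binary.PropositionalEquality
open import Relation.Nullary using (¬_; yes; no)
open import Relation.Nullary.Decidable using (dec⇒maybe)
import Tactic.RingSolver as ℚSolver
import Tactic.RingSolver.Core.AlmostCommutativeRing as ACR

-- Exponents modulo 2

ℚᵘ-ring : ACR.AlmostCommutativeRing 0ℓ 0ℓ
ℚᵘ-ring = ACR.fromCommutativeRing ℚP.+-*-commutativeRing (λ x → dec⇒maybe (Q.0ℚᵘ ℚP.≃? x))

IsEven : ℚᵘ → Set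
IsEven p = ∃ λ m → p ≃ ℤ→ℚ (+ 2 ℤ.* m)

IsEven-resp-≃ : ∀ {p q} → p ≃ q → IsEven q → IsEven p
IsEven-resp-≃ p≃q (m , q≃2m) = m , ℚP.≃-trans p≃q q≃2m

IsEven-+ : ∀ {p q} → IsEven p → IsEven q → IsEven (p Q.+ q)
IsEven-+ (m , p≃2m) (n , q≃2n) =
  m ℤ.+ n , ℚP.≃-trans (ℚP.+-cong p≃2m q≃2n) (*≡* (sum m n))
  where
  sum : ∀ m n → (+ 2 ℤ.* m ℤ.* + 1 ℤ.+ + 2 ℤ.* n ℤ.* + 1) ℤ.* + 1 ≡ + 2 ℤ.* (m ℤ.+ n) ℤ.* (+ 1 ℤ.* + 1)
  sum = solve-∀

IsEven-neg : ∀ {p} → IsEven p → IsEven (Q.- p)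
IsEven-neg (m , p≃2m) =
  ℤ.- m , ℚP.≃-trans (ℚP.-‿cong p≃2m) (*≡* (cong (ℤ._* + 1) (ℤP.neg-distribʳ-* (+ 2) m)))

IsEven-*ˡ : ∀ c {p} → IsEven p → IsEven (ℤ→ℚ c Q.* p)
IsEven-*ˡ c (m , p≃2m) = c ℤ.* m , ℚP.≃-trans (ℚP.*-congˡ {ℤ→ℚ c} p≃2m) (*≡* (scale c m))
  where
  scale : ∀ c m → c ℤ.* (+ 2 ℤ.* m) ℤ.* + 1 ≡ + 2 ℤ.* (c ℤ.* m) ℤ.* + 1
  scale = solve-∀

infix 4 _≋_

-- _≈π_ as a record, so that Agda can infer both sides from a proof.
record _≋_ (t s : ℚᵘ) : Set where
  constructor ≈π⇒≋
  field ≋⇒≈π : t ≈π s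
open _≋_ public

≃⇒≋ : ∀ {t s} → t ≃ s → t ≋ s
≃⇒≋ {t} {s} t≃s = ≈π⇒≋ (ℤ.0ℤ , ℚP.≃-trans (ℚP.+-congˡ (Q.- s) t≃s) (ℚP.+-inverseʳ s))

≋-trans : ∀ {t s u} → t ≋ s → s ≋ u → t ≋ u
≋-trans {t} {s} {u} (≈π⇒≋ t≈s) (≈π⇒≋ s≈u) =
  ≈π⇒≋ (IsEven-resp-≃ (split t s u) (IsEven-+ {t Q.- s} {s Q.- u} t≈s s≈u))
  where
  split : ∀ t s u → t Q.- u ≃ (t Q.- s) Q.+ (s Q.- u)
  split = ℚSolver.solve-∀ ℚᵘ-ring

≋-+ : ∀ {t s t′ s′} → t ≋ s → t′ ≋ s′ → t Q.+ t′ ≋ s Q.+ s′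
≋-+ {t} {s} {t′} {s′} (≈π⇒≋ t≈s) (≈π⇒≋ t′≈s′) =
  ≈π⇒≋ (IsEven-resp-≃ (split t s t′ s′) (IsEven-+ {t Q.- s} {t′ Q.- s′} t≈s t′≈s′))
  where
  split : ∀ t s t′ s′ → (t Q.+ t′) Q.- (s Q.+ s′) ≃ (t Q.- s) Q.+ (t′ Q.- s′)
  split = ℚSolver.solve-∀ ℚᵘ-ring

≋-neg : ∀ {t s} → t ≋ s → Q.- t ≋ Q.- s
≋-neg {t} {s} (≈π⇒≋ t≈s) = ≈π⇒≋ (IsEven-resp-≃ (split t s) (IsEven-neg {t Q.- s} t≈s))
  where
  split : ∀ t s → (Q.- t) Q.- (Q.- s) ≃ Q.- (t Q.- s)
  split = ℚSolver.solve-∀ ℚᵘ-ring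

≋-- : ∀ {t s t′ s′} → t ≋ s → t′ ≋ s′ → t Q.- t′ ≋ s Q.- s′
≋-- t≋s t′≋s′ = ≋-+ t≋s (≋-neg t′≋s′)

≋-*ˡ : ∀ c {t s} → t ≋ s → ℤ→ℚ c Q.* t ≋ ℤ→ℚ c Q.* s
≋-*ˡ c {t} {s} (≈π⇒≋ t≈s) = ≈π⇒≋ (IsEven-resp-≃ (split (ℤ→ℚ c) t s) (IsEven-*ˡ c {t Q.- s} t≈s))
  where
  split : ∀ c t s → c Q.* t Q.- c Q.* s ≃ c Q.* (t Q.- s)
  split = ℚSolver.solve-∀ ℚᵘ-ring

-- Rationals as integer fractions

infix 4 _≐_/_

record _≐_/_ (p : ℚᵘ) (n d : ℤ) : Set where
  constructor cross
  field cross-≡ : ↥ p ℤ.* d ≡ n ℤ.* ↧ p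

≐-mkℚᵘ : ∀ n d → mkℚᵘ n d ≐ n / + suc d
≐-mkℚᵘ n d = cross refl

≐-cong : ∀ {p n n′ d d′} → n ≡ n′ → d ≡ d′ → p ≐ n / d → p ≐ n′ / d′
≐-cong refl refl p≐ = p≐

≐-scale : ∀ {p n d} c {d′} → c ℤ.* d ≡ d′ → p ≐ n / d → p ≐ c ℤ.* n / d′
≐-scale {p} {n} {d} c refl (cross p≐) = cross (begin
  ↥ p ℤ.* (c ℤ.* d)   ≡⟨ swap (↥ p) c d ⟩
  c ℤ.* (↥ p ℤ.* d)   ≡⟨ cong (c ℤ.*_) p≐ ⟩
  c ℤ.* (n ℤ.* ↧ p)   ≡⟨ ℤP.*-assoc c n (↧ p) ⟨
  c ℤ.* n ℤ.* ↧ p     ∎)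
  where
  open ≡-Reasoning
  swap : ∀ a b c → a ℤ.* (b ℤ.* c) ≡ b ℤ.* (a ℤ.* c)
  swap = solve-∀

≐-+ : ∀ {p q a b d} → p ≐ a / d → q ≐ b / d → p Q.+ q ≐ a ℤ.+ b / d
≐-+ {mkℚᵘ pn pd} {mkℚᵘ qn qd} {a} {b} {d} (cross p≐) (cross q≐) = cross (begin
  (pn ℤ.* Q ℤ.+ qn ℤ.* P) ℤ.* d       ≡⟨ distrib pn Q qn P d ⟩
  (pn ℤ.* d) ℤ.* Q ℤ.+ (qn ℤ.* d) ℤ.* P ≡⟨ cong₂ (λ u v → u ℤ.* Q ℤ.+ v ℤ.* P) p≐ q≐ ⟩
  (a ℤ.* P) ℤ.* Q ℤ.+ (b ℤ.* Q) ℤ.* P  ≡⟨ collect a P Q b ⟩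
  (a ℤ.+ b) ℤ.* (P ℤ.* Q)              ∎)
  where
  open ≡-Reasoning
  P = + suc pd
  Q = + suc qd
  distrib : ∀ pn Q qn P d → (pn ℤ.* Q ℤ.+ qn ℤ.* P) ℤ.* d ≡ (pn ℤ.* d) ℤ.* Q ℤ.+ (qn ℤ.* d) ℤ.* P
  distrib = solve-∀
  collect : ∀ a P Q b → (a ℤ.* P) ℤ.* Q ℤ.+ (b ℤ.* Q) ℤ.* P ≡ (a ℤ.+ b) ℤ.* (P ℤ.* Q)
  collect = solve-∀

≐-neg : ∀ {p a d} → p ≐ a / d → Q.- p ≐ ℤ.- a / d
≐-neg {mkℚᵘ pn pd} {a} {d} (cross p≐) = cross (begin
  ℤ.- pn ℤ.* d       ≡⟨ ℤP.neg-distribˡ-* pn d ⟨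
  ℤ.- (pn ℤ.* d)     ≡⟨ cong ℤ.-_ p≐ ⟩
  ℤ.- (a ℤ.* + suc pd) ≡⟨ ℤP.neg-distribˡ-* a (+ suc pd) ⟩
  ℤ.- a ℤ.* + suc pd ∎)
  where open ≡-Reasoning

≐-- : ∀ {p q a b d} → p ≐ a / d → q ≐ b / d → p Q.- q ≐ a ℤ.- b / d
≐-- p≐ q≐ = ≐-+ p≐ (≐-neg q≐)

≐-* : ∀ {p q a b d e} → p ≐ a / d → q ≐ b / e → p Q.* q ≐ a ℤ.* b / d ℤ.* e
≐-* {mkℚᵘ pn pd} {mkℚᵘ qn qd} {a} {b} {d} {e} (cross p≐) (cross q≐) = cross (begin
  (pn ℤ.* qn) ℤ.* (d ℤ.* e)  ≡⟨ interchange pn qn d e ⟩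
  (pn ℤ.* d) ℤ.* (qn ℤ.* e)  ≡⟨ cong₂ ℤ._*_ p≐ q≐ ⟩
  (a ℤ.* P) ℤ.* (b ℤ.* Q)    ≡⟨ interchange a P b Q ⟩
  (a ℤ.* b) ℤ.* (P ℤ.* Q)    ∎)
  where
  open ≡-Reasoning
  P = + suc pd
  Q = + suc qd
  interchange : ∀ a b c d → (a ℤ.* b) ℤ.* (c ℤ.* d) ≡ (a ℤ.* c) ℤ.* (b ℤ.* d)
  interchange = solve-∀

≐⇒≋ : ∀ {t s a b d} M .{{_ : ℤ.NonZero d}} → t ≐ a / d → s ≐ b / d →
      a ℤ.- b ≡ + 2 ℤ.* M ℤ.* d → t ≋ s
≐⇒≋ {t} {s} {a} {b} {d} M t≐ s≐ a-b≡ = ≈π⇒≋ (M , *≡* (ℤP.*-cancelʳ-≡ _ _ d (begin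
  ↥ (t Q.- s) ℤ.* + 1 ℤ.* d    ≡⟨ cong (ℤ._* d) (ℤP.*-identityʳ (↥ (t Q.- s))) ⟩
  ↥ (t Q.- s) ℤ.* d            ≡⟨ _≐_/_.cross-≡ (≐-- t≐ s≐) ⟩
  (a ℤ.- b) ℤ.* ↧ (t Q.- s)    ≡⟨ cong (ℤ._* ↧ (t Q.- s)) a-b≡ ⟩
  + 2 ℤ.* M ℤ.* d ℤ.* ↧ (t Q.- s) ≡⟨ swap (+ 2 ℤ.* M) d (↧ (t Q.- s)) ⟩
  + 2 ℤ.* M ℤ.* ↧ (t Q.- s) ℤ.* d ∎)))
  where
  open ≡-Reasoning
  swap : ∀ a b c → a ℤ.* b ℤ.* c ≡ a ℤ.* c ℤ.* b
  swap = solve-∀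

-- Residues, divisibility and coprimality

odd⇒%2≡1 : ∀ {n} → ¬ 2 ℕD.∣ n → n % 2 ≡ 1
odd⇒%2≡1 {n} 2∤n with n % 2 in n%2 | ℕDM.m%n<n n 2
... | 0 | _ = ⊥-elim (2∤n (ℕD.m%n≡0⇒n∣m n 2 n%2))
... | 1 | _ = refl
... | suc (suc _) | s≤s (s≤s ())

a%ℕd≡r⇒a≡r+[a/ℕd]*d : ∀ {x r} d .{{_ : ℕ.NonZero d}} → x %ℕ d ≡ r → x ≡ + r ℤ.+ (x /ℕ d) ℤ.* + d
a%ℕd≡r⇒a≡r+[a/ℕd]*d {x} d refl = a≡a%ℕn+[a/ℕn]*n x d

%ℕ≡0⇒∣ : ∀ {x} d .{{_ : ℕ.NonZero d}} → x %ℕ d ≡ 0 → + d ∣ x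
%ℕ≡0⇒∣ {x} d x%d≡0 =
  S.∣⇒∣ᵤ {+ d} {x} (S.divides (x /ℕ d)
    (trans (a%ℕd≡r⇒a≡r+[a/ℕd]*d {x} d x%d≡0) (ℤP.+-identityˡ (x /ℕ d ℤ.* + d))))

m+i*d≡n+j*d⇒m-n≡[j-i]*d : ∀ a b u v D → a ℤ.+ u ℤ.* D ≡ b ℤ.+ v ℤ.* D → a ℤ.- b ≡ (v ℤ.- u) ℤ.* D
m+i*d≡n+j*d⇒m-n≡[j-i]*d a b u v D eq = begin
  a ℤ.- b                                                   ≡⟨ solve (a ∷ b ∷ u ∷ v ∷ D ∷ []) ⟩
  (a ℤ.+ u ℤ.* D) ℤ.- (b ℤ.+ v ℤ.* D) ℤ.+ (v ℤ.- u) ℤ.* D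
    ≡⟨ cong (λ z → z ℤ.- (b ℤ.+ v ℤ.* D) ℤ.+ (v ℤ.- u) ℤ.* D) eq ⟩
  (b ℤ.+ v ℤ.* D) ℤ.- (b ℤ.+ v ℤ.* D) ℤ.+ (v ℤ.- u) ℤ.* D ≡⟨ solve (b ∷ u ∷ v ∷ D ∷ []) ⟩
  (v ℤ.- u) ℤ.* D                                           ∎
  where open ≡-Reasoning

%ℕ-unique : ∀ {x r} d .{{_ : ℕ.NonZero d}} t → r < d → x ≡ + r ℤ.+ t ℤ.* + d → x %ℕ d ≡ r
%ℕ-unique {x} {r} d t r<d x≡ =
  ℤP.+-injective (ℤP.i-j≡0⇒i≡j _ _ (ℤP.∣i∣≡0⇒i≡0 (small-multiple d∣r′-r bound)))
  where
  r′ = x %ℕ d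
  difference : + r′ ℤ.- + r ≡ (t ℤ.- x /ℕ d) ℤ.* + d
  difference = m+i*d≡n+j*d⇒m-n≡[j-i]*d (+ r′) (+ r) (x /ℕ d) t (+ d)
                 (trans (sym (a%ℕd≡r⇒a≡r+[a/ℕd]*d {x} d refl)) x≡)
  d∣r′-r : d ℕD.∣ ℤ.∣ + r′ ℤ.- + r ∣
  d∣r′-r = S.∣⇒∣ᵤ {+ d} (S.divides (t ℤ.- x /ℕ d) difference)
  bound : ℤ.∣ + r′ ℤ.- + r ∣ < d
  bound = subst (_< d) (cong ℤ.∣_∣ (sym (ℤP.[+m]-[+n]≡m⊖n r′ r)))
            (ℕP.≤-<-trans (ℤP.∣m⊝n∣≤m⊔n r′ r) (ℕP.⊔-lub (n%ℕd<d x d) r<d))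
  small-multiple : ∀ {n} → d ℕD.∣ n → n < d → n ≡ 0
  small-multiple {zero}  _   _   = refl
  small-multiple {suc _} d∣n n<d = ⊥-elim (ℕD.>⇒∤ n<d d∣n)

3∤⇒3∣n²-1 : ∀ {n} → ¬ (+ 3 ∣ n) → + 3 S.∣ n ℤ.* n ℤ.- ℤ.1ℤ
3∤⇒3∣n²-1 {n} 3∤n with n %ℕ 3 in n%3 | n%ℕd<d n 3
... | 0 | _ = ⊥-elim (3∤n (%ℕ≡0⇒∣ {n} 3 n%3))
... | 1 | _ = S.divides (t ℤ.* (+ 3 ℤ.* t ℤ.+ + 2))
                (trans (cong (λ z → z ℤ.* z ℤ.- ℤ.1ℤ) (a%ℕd≡r⇒a≡r+[a/ℕd]*d {n} 3 n%3)) (square t))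
  where
  t = n /ℕ 3
  square : ∀ t → (+ 1 ℤ.+ t ℤ.* + 3) ℤ.* (+ 1 ℤ.+ t ℤ.* + 3) ℤ.- ℤ.1ℤ ≡ t ℤ.* (+ 3 ℤ.* t ℤ.+ + 2) ℤ.* + 3
  square = solve-∀
... | 2 | _ = S.divides (+ 3 ℤ.* t ℤ.* t ℤ.+ + 4 ℤ.* t ℤ.+ ℤ.1ℤ)
                (trans (cong (λ z → z ℤ.* z ℤ.- ℤ.1ℤ) (a%ℕd≡r⇒a≡r+[a/ℕd]*d {n} 3 n%3)) (square t))
  where
  t = n /ℕ 3
  square : ∀ t → (+ 2 ℤ.+ t ℤ.* + 3) ℤ.* (+ 2 ℤ.+ t ℤ.* + 3) ℤ.- ℤ.1ℤ
                 ≡ (+ 3 ℤ.* t ℤ.* t ℤ.+ + 4 ℤ.* t ℤ.+ ℤ.1ℤ) ℤ.* + 3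
  square = solve-∀
... | suc (suc (suc _)) | s≤s (s≤s (s≤s ()))

8∣[1+2j]²-1 : ∀ j → + 8 S.∣ (+ 1 ℤ.+ + 2 ℤ.* + j) ℤ.* (+ 1 ℤ.+ + 2 ℤ.* + j) ℤ.- ℤ.1ℤ
8∣[1+2j]²-1 zero    = S.divides ℤ.0ℤ refl
8∣[1+2j]²-1 (suc j) = subst (+ 8 S.∣_) (sym (step (+ j)))
                        (S.∣m∣n⇒∣m+n (8∣[1+2j]²-1 j) (S.divides (+ suc j) refl))
  where
  step : ∀ J → (+ 1 ℤ.+ + 2 ℤ.* (+ 1 ℤ.+ J)) ℤ.* (+ 1 ℤ.+ + 2 ℤ.* (+ 1 ℤ.+ J)) ℤ.- ℤ.1ℤ
             ≡ ((+ 1 ℤ.+ + 2 ℤ.* J) ℤ.* (+ 1 ℤ.+ + 2 ℤ.* J) ℤ.- ℤ.1ℤ) ℤ.+ (+ 1 ℤ.+ J) ℤ.* + 8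
  step = solve-∀

odd⇒8∣n²-1 : ∀ {n} → ¬ 2 ℕD.∣ n → + 8 S.∣ + n ℤ.* + n ℤ.- ℤ.1ℤ
odd⇒8∣n²-1 {n} 2∤n = subst (λ z → + 8 S.∣ z ℤ.* z ℤ.- ℤ.1ℤ) (sym n≡1+2j) (8∣[1+2j]²-1 (n / 2))
  where
  n≡1+2j : + n ≡ + 1 ℤ.+ + 2 ℤ.* + (n / 2)
  n≡1+2j = trans (cong +_ (trans (ℕDM.m≡m%n+[m/n]*n n 2)
                                  (cong₂ ℕ._+_ (odd⇒%2≡1 2∤n) (ℕP.*-comm (n / 2) 2))))
                 (cong (ℤ._+_ (+ 1)) (ℤP.pos-* 2 (n / 2)))

3∣∧8∣⇒24∣ : ∀ {n} → + 3 S.∣ n → + 8 S.∣ n → + 24 S.∣ n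
3∣∧8∣⇒24∣ {n} (S.divides s n≡3s) (S.divides t n≡8t) = S.divides (+ 3 ℤ.* t ℤ.- s) (begin
  n                                   ≡⟨ split n ⟩
  + 9 ℤ.* n ℤ.- + 8 ℤ.* n             ≡⟨ cong₂ (λ u v → + 9 ℤ.* u ℤ.- + 8 ℤ.* v) n≡8t n≡3s ⟩
  + 9 ℤ.* (t ℤ.* + 8) ℤ.- + 8 ℤ.* (s ℤ.* + 3) ≡⟨ regroup t s ⟩
  (+ 3 ℤ.* t ℤ.- s) ℤ.* + 24          ∎)
  where
  open ≡-Reasoning
  split : ∀ n → n ≡ + 9 ℤ.* n ℤ.- + 8 ℤ.* n
  split = solve-∀
  regroup : ∀ t s → + 9 ℤ.* (t ℤ.* + 8) ℤ.- + 8 ℤ.* (s ℤ.* + 3) ≡ (+ 3 ℤ.* t ℤ.- s) ℤ.* + 24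
  regroup = solve-∀

24∣[K²-1][H²-1] : ∀ {H K} → ¬ 2 ℕD.∣ K → Coprime H (+ K) →
                  + 24 S.∣ (+ K ℤ.* + K ℤ.- ℤ.1ℤ) ℤ.* (H ℤ.* H ℤ.- ℤ.1ℤ)
24∣[K²-1][H²-1] {H} {K} 2∤K H⊥K =
  3∣∧8∣⇒24∣ {(+ K ℤ.* + K ℤ.- ℤ.1ℤ) ℤ.* (H ℤ.* H ℤ.- ℤ.1ℤ)} 3∣product
            (S.∣m⇒∣m*n (H ℤ.* H ℤ.- ℤ.1ℤ) (odd⇒8∣n²-1 2∤K))
  where
  3∣product : + 3 S.∣ (+ K ℤ.* + K ℤ.- ℤ.1ℤ) ℤ.* (H ℤ.* H ℤ.- ℤ.1ℤ)
  3∣product with + 3 S.∣? H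
  ... | no 3∤H  = S.∣n⇒∣m*n (+ K ℤ.* + K ℤ.- ℤ.1ℤ) (3∤⇒3∣n²-1 {H} (3∤H ∘ S.∣ᵤ⇒∣))
  ... | yes 3∣H = S.∣m⇒∣m*n (H ℤ.* H ℤ.- ℤ.1ℤ) (3∤⇒3∣n²-1 {+ K} (λ 3∣K → 3≢1 (H⊥K (S.∣⇒∣ᵤ 3∣H , 3∣K))))
    where
    3≢1 : 3 ≢ 1
    3≢1 ()

odd⇒coprime-2 : ∀ {n} → ¬ 2 ℕD.∣ n → ℕC.Coprime n 2
odd⇒coprime-2 2∤n (i∣n , i∣2) with irreducible[2] i∣2
... | inj₁ i≡1 = i≡1
... | inj₂ refl = ⊥-elim (2∤n i∣n)

Coprime-2* : ∀ {a n} → ¬ 2 ℕD.∣ n → Coprime a (+ n) → Coprime (+ 2 ℤ.* a) (+ n)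
Coprime-2* {a} 2∤n a⊥n (i∣2a , i∣n) =
  a⊥n (ℕC.coprime-divisor (odd⇒coprime-2 (λ 2∣i → 2∤n (ℕD.∣-trans 2∣i i∣n)))
                          (subst (_ ℕD.∣_) (ℤP.abs-* (+ 2) a) i∣2a) , i∣n)

Coprime-neg : ∀ {a b} → Coprime a b → Coprime (ℤ.- a) b
Coprime-neg {a} {b} = subst (λ n → ℕC.Coprime n ℤ.∣ b ∣) (sym (ℤP.∣-i∣≡∣i∣ a))

Coprime-∣ : ∀ {a m n} → m ℕD.∣ n → Coprime a (+ n) → Coprime a (+ m)
Coprime-∣ m∣n a⊥n (i∣a , i∣m) = a⊥n (i∣a , ℕD.∣-trans i∣m m∣n)

gcd[n,6]≡3⇒3∣n : ∀ {n} → gcd n 6 ≡ 3 → 3 ℕD.∣ n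
gcd[n,6]≡3⇒3∣n {n} n⊓6≡3 = subst (ℕD._∣ n) n⊓6≡3 (gcd[m,n]∣m n 6)

gcd[n,6]≡3⇒2∤n : ∀ {n} → gcd n 6 ≡ 3 → ¬ 2 ℕD.∣ n
gcd[n,6]≡3⇒2∤n n⊓6≡3 2∣n
  with () ← ℕD.n∣m⇒m%n≡0 3 2 (subst (2 ℕD.∣_) n⊓6≡3 (gcd-greatest 2∣n (ℕD.divides 3 refl)))

-- The phase of ω_{H,K} for odd K

phase : ℤ → ℕ → ℤ → ℚᵘ
phase H K x = mkℚᵘ (+ K ℤ.- ℤ.1ℤ) 3
  Q.+ mkℚᵘ ℤ.1ℤ 11 Q.* KminusInvK K Q.* ℤ→ℚ (+ 2 ℤ.* H ℤ.- x ℤ.+ H ℤ.* H ℤ.* x)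

omegaExp-odd : ∀ H {K} x → ¬ 2 ℕD.∣ K →
               omegaExp H K x ≡ signExp (kronecker (ℤ.- H) (+ K)) Q.- phase H K x
omegaExp-odd H x 2∤K rewrite odd⇒%2≡1 2∤K = refl

phaseNum : ℤ → ℤ → ℤ → ℤ
phaseNum H K x =
  + 3 ℤ.* K ℤ.* (K ℤ.- ℤ.1ℤ) ℤ.+ (K ℤ.* K ℤ.- ℤ.1ℤ) ℤ.* (+ 2 ℤ.* H ℤ.- x ℤ.+ H ℤ.* H ℤ.* x)
-- Inlined so that the ring solver can expand it.
{-# INLINE phaseNum #-}

phase-≐ : ∀ H n x → phase H (suc n) x ≐ phaseNum H (+ suc n) x / + 12 ℤ.* + suc n
phase-≐ H n x =
  ≐-cong (cong (λ c → + 3 ℤ.* K ℤ.* (K ℤ.- ℤ.1ℤ) ℤ.+ c ℤ.* P) (ℤP.*-identityˡ (K ℤ.* K ℤ.- ℤ.1ℤ))) refl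
         (≐-+ quarter (≐-cong refl (ℤP.*-identityʳ (+ 12 ℤ.* K)) rest))
  where
  K = + suc n
  P = + 2 ℤ.* H ℤ.- x ℤ.+ H ℤ.* H ℤ.* x
  K-K⁻¹ : KminusInvK (suc n) ≐ K ℤ.* K ℤ.- ℤ.1ℤ / K
  K-K⁻¹ = ≐-- (≐-scale K (ℤP.*-identityʳ K) (≐-mkℚᵘ K 0)) (≐-mkℚᵘ ℤ.1ℤ n)
  twelve : ∀ K → + 3 ℤ.* K ℤ.* + 4 ≡ + 12 ℤ.* K
  twelve = solve-∀
  quarter : mkℚᵘ (K ℤ.- ℤ.1ℤ) 3 ≐ + 3 ℤ.* K ℤ.* (K ℤ.- ℤ.1ℤ) / + 12 ℤ.* K
  quarter = ≐-scale (+ 3 ℤ.* K) (twelve K) (≐-mkℚᵘ _ 3)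
  rest = ≐-* (≐-* (≐-mkℚᵘ ℤ.1ℤ 11) K-K⁻¹) (≐-mkℚᵘ P 0)

phase-≐-3* : ∀ H n x →
             phase H (3 ℕ.* suc n) x ≐ phaseNum H (+ 3 ℤ.* + suc n) x / + 12 ℤ.* (+ 3 ℤ.* + suc n)
phase-≐-3* H n x = ≐-cong (cong (λ K → phaseNum H K x) 3m) (cong (+ 12 ℤ.*_) 3m) (phase-≐ H _ x)
  where
  3m = ℤP.pos-* 3 (suc n)

phase-cong : ∀ {H n x y} → + 24 S.∣ (+ suc n ℤ.* + suc n ℤ.- ℤ.1ℤ) ℤ.* (H ℤ.* H ℤ.- ℤ.1ℤ) →
             + suc n S.∣ x ℤ.- y → phase H (suc n) x ≋ phase H (suc n) y
phase-cong {H} {n} {x} {y} (S.divides w 24w) (S.divides t Kt) =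
  ≐⇒≋ (w ℤ.* t) (phase-≐ H n x) (phase-≐ H n y) (begin
    phaseNum H K x ℤ.- phaseNum H K y                   ≡⟨ shift H K x y ⟩
    (K ℤ.* K ℤ.- ℤ.1ℤ) ℤ.* (H ℤ.* H ℤ.- ℤ.1ℤ) ℤ.* (x ℤ.- y) ≡⟨ cong₂ ℤ._*_ 24w Kt ⟩
    w ℤ.* + 24 ℤ.* (t ℤ.* K)                             ≡⟨ regroup w t K ⟩
    + 2 ℤ.* (w ℤ.* t) ℤ.* (+ 12 ℤ.* K)                   ∎)
  where
  open ≡-Reasoning
  K = + suc n
  shift : ∀ H K x y → phaseNum H K x ℤ.- phaseNum H K y
                      ≡ (K ℤ.* K ℤ.- ℤ.1ℤ) ℤ.* (H ℤ.* H ℤ.- ℤ.1ℤ) ℤ.* (x ℤ.- y)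
  shift = solve-∀
  regroup : ∀ w t K → w ℤ.* + 24 ℤ.* (t ℤ.* K) ≡ + 2 ℤ.* (w ℤ.* t) ℤ.* (+ 12 ℤ.* K)
  regroup = solve-∀

IsStar-unique : ∀ {H K x y} → Coprime H (+ K) → IsStar H K x → IsStar H K y → + K S.∣ x ℤ.- y
IsStar-unique {H} {K} {x} {y} H⊥K x* y* =
  S.∣ᵤ⇒∣ (ℤC.coprime-divisor (+ K) H (x ℤ.- y) (ℤC.sym {H} {+ K} H⊥K) (S.∣⇒∣ᵤ K∣H[x-y]))
  where
  difference : ∀ H x y → (H ℤ.* x ℤ.+ ℤ.1ℤ) ℤ.- (H ℤ.* y ℤ.+ ℤ.1ℤ) ≡ H ℤ.* (x ℤ.- y)
  difference = solve-∀
  K∣H[x-y] : + K S.∣ H ℤ.* (x ℤ.- y)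
  K∣H[x-y] = subst (+ K S.∣_) (difference H x y)
               (S.∣m∣n⇒∣m-n {+ K} {H ℤ.* x ℤ.+ ℤ.1ℤ} {H ℤ.* y ℤ.+ ℤ.1ℤ} (S.∣ᵤ⇒∣ x*) (S.∣ᵤ⇒∣ y*))

IsStar-∣ : ∀ H x {K L} → K ℕD.∣ L → IsStar H L x → IsStar H K x
IsStar-∣ H x K∣L x* = ℕD.∣-trans K∣L x*

IsStar-2* : ∀ H e {K} → IsStar H K (e ℤ.* + 2) → IsStar (+ 2 ℤ.* H) K e
IsStar-2* H e {K} = subst (λ z → + K ∣ z ℤ.+ ℤ.1ℤ) (reassoc H e)
  where
  reassoc : ∀ H e → H ℤ.* (e ℤ.* + 2) ≡ + 2 ℤ.* H ℤ.* e
  reassoc = solve-∀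

omegaExp-≋-phase : ∀ {H K x y} → ¬ 2 ℕD.∣ K → Coprime H (+ K) → IsStar H K x → IsStar H K y →
                     omegaExp H K x ≋ signExp (kronecker (ℤ.- H) (+ K)) Q.- phase H K y
omegaExp-≋-phase {H} {zero}  2∤K _ _ _ = ⊥-elim (2∤K (2 ℕD.∣0))
omegaExp-≋-phase {H} {suc n} {x} {y} 2∤K H⊥K x* y* rewrite omegaExp-odd H x 2∤K =
  ≋-- (≃⇒≋ (ℚP.≃-refl {signExp (kronecker (ℤ.- H) (+ suc n))}))
      (phase-cong {H} {n} {x} {y} (24∣[K²-1][H²-1] {H} {suc n} 2∤K H⊥K)
                                  (IsStar-unique {H} {suc n} {x} {y} H⊥K x* y*))

-- The Kronecker symbol

IsSign : ℤ → Set
IsSign z = z ≡ ℤ.1ℤ ⊎ z ≡ ℤ.-1ℤ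

IsSign-* : ∀ {a b} → IsSign a → IsSign b → IsSign (a ℤ.* b)
IsSign-* (inj₁ refl) (inj₁ refl) = inj₁ refl
IsSign-* (inj₁ refl) (inj₂ refl) = inj₂ refl
IsSign-* (inj₂ refl) (inj₁ refl) = inj₂ refl
IsSign-* (inj₂ refl) (inj₂ refl) = inj₁ refl

IsSign-if : ∀ b → IsSign (if b then ℤ.1ℤ else ℤ.-1ℤ)
IsSign-if true  = inj₁ refl
IsSign-if false = inj₂ refl

-- Defs computes leastDivisor and kronNat with where-bound loops, which cannot be
-- named outside Defs.  Each loop is bound here to a metavariable, solved by
-- unification in the with-abstracted unfolding lemma next to it.
mutual
  leastDivisorLoop : ℕ → ℕ → ℕ → ℕ
  leastDivisorLoop = _

  leastDivisor-odd : ∀ {f} → ¬ 2 ℕD.∣ suc f → leastDivisor (suc f) ≡ leastDivisorLoop (suc f) f 3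
  leastDivisor-odd {f} 2∤ with 2 ℕD.∣? suc f
  ... | yes 2∣ = ⊥-elim (2∤ 2∣)
  ... | no _ with suc f
  ... | m with 3
  ... | d = refl

mutual
  kronNatLoop : ℤ → ℕ → ℕ → ℕ → ℤ
  kronNatLoop = _

  kronNatIteration : ℤ → ℕ → ℕ → ℕ → ℤ
  kronNatIteration a n f m with m ℕ.≤? 1
  ... | yes _ = ℤ.1ℤ
  ... | no _  = kronPrime a (leastDivisor m) ℤ.* kronNatLoop a n f (divBy m (leastDivisor m))

  kronNat-2+ : ∀ a f → let n = suc (suc f); p = leastDivisor n in
               kronNat a n ≡ kronPrime a p ℤ.* kronNatIteration a n f (divBy n p)
  kronNat-2+ a f with leastDivisor (suc (suc f))
  ... | p with divBy (suc (suc f)) p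
  ... | w with suc (suc f)
  ... | n with w ℕ.≤? 1
  ... | yes _ = refl
  ... | no _ with leastDivisor w
  ... | p′ with divBy w p′
  ... | w′ = refl

leastDivisorLoop-spec : ∀ m f d → 2 ≤ d → 2 ≤ m →
                        2 ≤ leastDivisorLoop m f d × leastDivisorLoop m f d ℕD.∣ m
leastDivisorLoop-spec m zero    d _   2≤m = 2≤m , ℕD.∣-refl
leastDivisorLoop-spec m (suc f) d 2≤d 2≤m with d ℕD.∣? m
... | yes d∣m = 2≤d , d∣m
... | no _    = leastDivisorLoop-spec m f (suc d) (ℕP.m≤n⇒m≤1+n 2≤d) 2≤m

leastDivisor-spec : ∀ {m} → 2 ≤ m → 2 ≤ leastDivisor m × leastDivisor m ℕD.∣ m
leastDivisor-spec {m} = leastDivisorLoop-spec m m 2 ℕP.≤-refl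

leastDivisor-3 : ∀ {n} → ¬ 2 ℕD.∣ n → 3 ℕD.∣ n → leastDivisor n ≡ 3
leastDivisor-3 {zero}              2∤n _   = ⊥-elim (2∤n (2 ℕD.∣0))
leastDivisor-3 {1}                 _   3∣1 with s≤s () ← ℕD.∣⇒≤ 3∣1
leastDivisor-3 {2}                 _   3∣2 with s≤s (s≤s ()) ← ℕD.∣⇒≤ 3∣2
leastDivisor-3 {n@(suc (suc (suc t)))} 2∤n 3∣n = trans (leastDivisor-odd 2∤n) 3-divides
  where
  3-divides : leastDivisorLoop n (suc (suc t)) 3 ≡ 3
  3-divides with 3 ℕD.∣? n
  ... | yes _   = refl
  ... | no  3∤n = ⊥-elim (3∤n 3∣n)

divBy-∣ : ∀ {m p} → 2 ≤ p → p ℕD.∣ m → divBy m p ℕD.∣ m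
divBy-∣ {m} {suc p} _ p∣m = ℕD.divides (suc p) (sym (ℕDM.m*[n/m]≡n p∣m))

divBy-< : ∀ {m p} → 2 ≤ p → 2 ≤ m → divBy m p < m
divBy-< {suc m} {suc (suc p)} _ _ = ℕDM.m/n<m (suc m) (suc (suc p)) (s≤s (s≤s z≤n))
divBy-< {suc m} {1} (s≤s ()) _

kronNatLoop-suc : ∀ a n f m → kronNatLoop a n (suc f) m ≡ kronNatIteration a n f m
kronNatLoop-suc a n f m with m ℕ.≤? 1
... | yes _ = refl
... | no _  = refl

kronNatLoop-fuel : ∀ a n n′ f f′ m → m ≤ f → m ≤ f′ → kronNatLoop a n f m ≡ kronNatLoop a n′ f′ m
kronNatLoop-fuel a n n′ zero    zero     .0 z≤n _   = refl
kronNatLoop-fuel a n n′ zero    (suc f′) .0 z≤n _   = refl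
kronNatLoop-fuel a n n′ (suc f) zero     .0 _   z≤n = refl
kronNatLoop-fuel a n n′ (suc f) (suc f′) m  m≤f m≤f′ with m ℕ.≤? 1
... | yes _  = refl
... | no m≰1 = cong (kronPrime a p ℤ.*_)
                 (kronNatLoop-fuel a n n′ f f′ (divBy m p) (shrink m≤f) (shrink m≤f′))
  where
  p = leastDivisor m
  2≤m = ℕP.≰⇒> m≰1
  shrink : ∀ {g} → m ≤ suc g → divBy m p ≤ g
  shrink m≤g = ℕP.≤-pred (ℕP.<-≤-trans (divBy-< (proj₁ (leastDivisor-spec 2≤m)) 2≤m) m≤g)

kronNat-unfold : ∀ a {m} → 2 ≤ m →
                 kronNat a m ≡ kronPrime a (leastDivisor m) ℤ.* kronNat a (divBy m (leastDivisor m))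
kronNat-unfold a {1} (s≤s ())
kronNat-unfold a {m@(suc (suc f))} 2≤m = trans (kronNat-2+ a f) (cong (kronPrime a p ℤ.*_) (begin
  kronNatIteration a m f w  ≡⟨ kronNatLoop-suc a m f w ⟨
  kronNatLoop a m (suc f) w ≡⟨ kronNatLoop-fuel a m w (suc f) w w w<m ℕP.≤-refl ⟩
  kronNat a w               ∎))
  where
  open ≡-Reasoning
  p = leastDivisor m
  w = divBy m p
  w<m = ℕP.≤-pred (divBy-< (proj₁ (leastDivisor-spec 2≤m)) 2≤m)

kronPrime-±1 : ∀ {a p} → 2 ≤ p → p ≢ 2 → ¬ (+ p ∣ a) → IsSign (kronPrime a p)
kronPrime-±1 {a} {suc q} _ p≢2 p∤a with suc q ℕ.≟ 2
... | yes p≡2 = ⊥-elim (p≢2 p≡2)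
... | no _ with a %ℕ suc q ℕ.≟ 0
... | yes a%p≡0 = ⊥-elim (p∤a (%ℕ≡0⇒∣ {a} (suc q) a%p≡0))
... | no _      = IsSign-if _

kronNatLoop-±1 : ∀ {a N} → ¬ 2 ℕD.∣ N → Coprime a (+ N) →
                 ∀ n f m → m ℕD.∣ N → IsSign (kronNatLoop a n f m)
kronNatLoop-±1 2∤N a⊥N n zero    m m∣N = inj₁ refl
kronNatLoop-±1 {a} {N} 2∤N a⊥N n (suc f) m m∣N with m ℕ.≤? 1
... | yes _  = inj₁ refl
... | no m≰1 = IsSign-* (kronPrime-±1 2≤p p≢2 p∤a)
                 (kronNatLoop-±1 2∤N a⊥N n f (divBy m p) (ℕD.∣-trans (divBy-∣ 2≤p p∣m) m∣N))
  where
  p = leastDivisor m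
  2≤p = proj₁ (leastDivisor-spec (ℕP.≰⇒> m≰1))
  p∣m = proj₂ (leastDivisor-spec (ℕP.≰⇒> m≰1))
  p≢2 : p ≢ 2
  p≢2 p≡2 = 2∤N (subst (ℕD._∣ N) p≡2 (ℕD.∣-trans p∣m m∣N))
  p∤a : ¬ (+ p ∣ a)
  p∤a p∣a with s≤s () ← subst (2 ≤_) (a⊥N (p∣a , ℕD.∣-trans p∣m m∣N)) 2≤p

kronecker-±1 : ∀ {a N} → ¬ 2 ℕD.∣ N → Coprime a (+ N) → IsSign (kronecker a (+ N))
kronecker-±1 {a} {zero}  2∤N _   = ⊥-elim (2∤N (2 ℕD.∣0))
kronecker-±1 {a} {suc n} 2∤N a⊥N = kronNatLoop-±1 2∤N a⊥N (suc n) (suc n) (suc n) ℕD.∣-refl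

kronecker-3* : ∀ a {m} → ¬ 2 ℕD.∣ 3 ℕ.* m →
               kronecker a (+ (3 ℕ.* m)) ≡ kronPrime a 3 ℤ.* kronecker a (+ m)
kronecker-3* a {zero}   2∤3m = ⊥-elim (2∤3m (2 ℕD.∣0))
kronecker-3* a {suc m′} 2∤3m = begin
  kronNat a (3 ℕ.* m)                ≡⟨ kronNat-unfold a 2≤3m ⟩
  kronPrime a (leastDivisor (3 ℕ.* m)) ℤ.* kronNat a (divBy (3 ℕ.* m) (leastDivisor (3 ℕ.* m)))
    ≡⟨ cong (λ p → kronPrime a p ℤ.* kronNat a (divBy (3 ℕ.* m) p))
            (leastDivisor-3 2∤3m (ℕD.divides m (ℕP.*-comm 3 m))) ⟩
  kronPrime a 3 ℤ.* kronNat a (3 ℕ.* m / 3) ≡⟨ cong (λ w → kronPrime a 3 ℤ.* kronNat a w) 3m/3≡m ⟩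
  kronPrime a 3 ℤ.* kronNat a m      ∎
  where
  open ≡-Reasoning
  m = suc m′
  2≤3m : 2 ≤ 3 ℕ.* m
  2≤3m = ℕP.≤-trans (s≤s (s≤s z≤n)) (ℕP.*-monoʳ-≤ 3 (s≤s z≤n))
  3m/3≡m : 3 ℕ.* m / 3 ≡ m
  3m/3≡m = trans (cong (_/ 3) (ℕP.*-comm 3 m)) (ℕDM.m*n/n≡m m 3)

kronPrime-3≡1 : ∀ x → x %ℕ 3 ≡ 1 → kronPrime x 3 ≡ ℤ.1ℤ
kronPrime-3≡1 x x%3≡1 rewrite x%3≡1 = refl

kronPrime-3≡-1 : ∀ x → x %ℕ 3 ≡ 2 → kronPrime x 3 ≡ ℤ.-1ℤ
kronPrime-3≡-1 x x%3≡2 rewrite x%3≡2 = refl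

Legendre-3-pair : ℤ → ℤ → ℤ → Set
Legendre-3-pair x χ χ′ = kronPrime (ℤ.- (+ 2 ℤ.* x)) 3 ≡ χ × kronPrime (ℤ.- x) 3 ≡ χ′

kronPrime-3-residue-1 : ∀ t → Legendre-3-pair (+ 1 ℤ.+ t ℤ.* + 3) ℤ.1ℤ ℤ.-1ℤ
kronPrime-3-residue-1 t =
    kronPrime-3≡1 (ℤ.- (+ 2 ℤ.* x)) (%ℕ-unique 3 (ℤ.- (+ 2) ℤ.* t ℤ.- ℤ.1ℤ) (s≤s (s≤s z≤n)) (−2x t))
  , kronPrime-3≡-1 (ℤ.- x) (%ℕ-unique 3 (ℤ.- t ℤ.- ℤ.1ℤ) ℕP.≤-refl (−x t))
  where
  x = + 1 ℤ.+ t ℤ.* + 3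
  −2x : ∀ t → ℤ.- (+ 2 ℤ.* (+ 1 ℤ.+ t ℤ.* + 3)) ≡ + 1 ℤ.+ (ℤ.- (+ 2) ℤ.* t ℤ.- ℤ.1ℤ) ℤ.* + 3
  −2x = solve-∀
  −x : ∀ t → ℤ.- (+ 1 ℤ.+ t ℤ.* + 3) ≡ + 2 ℤ.+ (ℤ.- t ℤ.- ℤ.1ℤ) ℤ.* + 3
  −x = solve-∀

kronPrime-3-residue-2 : ∀ t → Legendre-3-pair (+ 2 ℤ.+ t ℤ.* + 3) ℤ.-1ℤ ℤ.1ℤ
kronPrime-3-residue-2 t =
    kronPrime-3≡-1 (ℤ.- (+ 2 ℤ.* x)) (%ℕ-unique 3 (ℤ.- (+ 2) ℤ.* t ℤ.- + 2) ℕP.≤-refl (−2x t))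
  , kronPrime-3≡1 (ℤ.- x) (%ℕ-unique 3 (ℤ.- t ℤ.- ℤ.1ℤ) (s≤s (s≤s z≤n)) (−x t))
  where
  x = + 2 ℤ.+ t ℤ.* + 3
  −2x : ∀ t → ℤ.- (+ 2 ℤ.* (+ 2 ℤ.+ t ℤ.* + 3)) ≡ + 2 ℤ.+ (ℤ.- (+ 2) ℤ.* t ℤ.- + 2) ℤ.* + 3
  −2x = solve-∀
  −x : ∀ t → ℤ.- (+ 2 ℤ.+ t ℤ.* + 3) ≡ + 1 ℤ.+ (ℤ.- t ℤ.- ℤ.1ℤ) ℤ.* + 3
  −x = solve-∀

kronPrime-3-−2h : ∀ {h} → ¬ (+ 3 ∣ h) →
  Legendre-3-pair h ℤ.1ℤ ℤ.-1ℤ ⊎ Legendre-3-pair h ℤ.-1ℤ ℤ.1ℤ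
kronPrime-3-−2h {h} 3∤h with h %ℕ 3 in h%3 | n%ℕd<d h 3
... | 0 | _ = ⊥-elim (3∤h (%ℕ≡0⇒∣ {h} 3 h%3))
... | 1 | _ = inj₁ (subst (λ x → Legendre-3-pair x _ _) (sym (a%ℕd≡r⇒a≡r+[a/ℕd]*d {h} 3 h%3))
                        (kronPrime-3-residue-1 (h /ℕ 3)))
... | 2 | _ = inj₂ (subst (λ x → Legendre-3-pair x _ _) (sym (a%ℕd≡r⇒a≡r+[a/ℕd]*d {h} 3 h%3))
                        (kronPrime-3-residue-2 (h /ℕ 3)))
... | suc (suc (suc _)) | s≤s (s≤s (s≤s ()))

signExp-identities : ∀ {εa εb εc εd χ χ′} → IsSign εa → IsSign εd →
  (χ ≡ ℤ.1ℤ × χ′ ≡ ℤ.-1ℤ) ⊎ (χ ≡ ℤ.-1ℤ × χ′ ≡ ℤ.1ℤ) → εb ≡ χ ℤ.* εa → εc ≡ χ′ ℤ.* εd →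
  (signExp εa Q.+ signExp εb Q.+ signExp εc Q.- signExp εd ≋ ℤ→ℚ ℤ.1ℤ) ×
  (signExp εd Q.+ signExp εb Q.+ signExp εc Q.- ℤ→ℚ (+ 3) Q.* signExp εa ≋ ℤ→ℚ ℤ.1ℤ)
signExp-identities (inj₁ refl) (inj₁ refl) (inj₁ (refl , refl)) refl refl =
  ≈π⇒≋ (+ 0 , *≡* refl) , ≈π⇒≋ (+ 0 , *≡* refl)
signExp-identities (inj₁ refl) (inj₂ refl) (inj₁ (refl , refl)) refl refl =
  ≈π⇒≋ (ℤ.-1ℤ , *≡* refl) , ≈π⇒≋ (+ 0 , *≡* refl)
signExp-identities (inj₂ refl) (inj₁ refl) (inj₁ (refl , refl)) refl refl =
  ≈π⇒≋ (+ 1 , *≡* refl) , ≈π⇒≋ (ℤ.-1ℤ , *≡* refl)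
signExp-identities (inj₂ refl) (inj₂ refl) (inj₁ (refl , refl)) refl refl =
  ≈π⇒≋ (+ 0 , *≡* refl) , ≈π⇒≋ (ℤ.-1ℤ , *≡* refl)
signExp-identities (inj₁ refl) (inj₁ refl) (inj₂ (refl , refl)) refl refl =
  ≈π⇒≋ (+ 0 , *≡* refl) , ≈π⇒≋ (+ 0 , *≡* refl)
signExp-identities (inj₁ refl) (inj₂ refl) (inj₂ (refl , refl)) refl refl =
  ≈π⇒≋ (+ 0 , *≡* refl) , ≈π⇒≋ (+ 1 , *≡* refl)
signExp-identities (inj₂ refl) (inj₁ refl) (inj₂ (refl , refl)) refl refl =
  ≈π⇒≋ (+ 0 , *≡* refl) , ≈π⇒≋ (ℤ.- + 2 , *≡* refl)
signExp-identities (inj₂ refl) (inj₂ refl) (inj₂ (refl , refl)) refl refl =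
  ≈π⇒≋ (+ 0 , *≡* refl) , ≈π⇒≋ (ℤ.-1ℤ , *≡* refl)

kronecker-signExp-identities : ∀ {m k} h → 3 ℕ.* m ≡ k → ¬ 2 ℕD.∣ k → Coprime h (+ k) →
  let εa = kronecker (ℤ.- (+ 2 ℤ.* h)) (+ m); εb = kronecker (ℤ.- (+ 2 ℤ.* h)) (+ k)
      εc = kronecker (ℤ.- h) (+ k);           εd = kronecker (ℤ.- h) (+ m)
  in (signExp εa Q.+ signExp εb Q.+ signExp εc Q.- signExp εd ≋ ℤ→ℚ ℤ.1ℤ) ×
     (signExp εd Q.+ signExp εb Q.+ signExp εc Q.- ℤ→ℚ (+ 3) Q.* signExp εa ≋ ℤ→ℚ ℤ.1ℤ)
kronecker-signExp-identities {m} h refl 2∤k h⊥k =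
  signExp-identities (kronecker-±1 {ℤ.- (+ 2 ℤ.* h)} {m} 2∤m (Coprime-neg {+ 2 ℤ.* h} {+ m} 2h⊥m))
                     (kronecker-±1 {ℤ.- h} {m} 2∤m (Coprime-neg {h} {+ m} h⊥m))
                     (kronPrime-3-−2h {h} 3∤h)
                     (kronecker-3* (ℤ.- (+ 2 ℤ.* h)) {m} 2∤k) (kronecker-3* (ℤ.- h) {m} 2∤k)
  where
  m∣3m : m ℕD.∣ 3 ℕ.* m
  m∣3m = ℕD.n∣m*n 3
  2∤m : ¬ 2 ℕD.∣ m
  2∤m 2∣m = 2∤k (ℕD.∣-trans 2∣m m∣3m)
  h⊥m = Coprime-∣ {h} m∣3m h⊥k
  2h⊥m = Coprime-2* {h} {m} 2∤m h⊥m
  3∤h : ¬ (+ 3 ∣ h)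
  3∤h 3∣h with () ← h⊥k (3∣h , ℕD.m∣m*n m)

phaseNum-identity₁ : ∀ h e q M T → M ℤ.* M ℤ.- ℤ.1ℤ ≡ T ℤ.* + 8 →
  h ℤ.* (e ℤ.* + 2) ℤ.+ ℤ.1ℤ ≡ q ℤ.* (+ 3 ℤ.* M) →
  + 9 ℤ.* phaseNum (+ 2 ℤ.* h) M e ℤ.+ + 3 ℤ.* phaseNum (+ 2 ℤ.* h) (+ 3 ℤ.* M) e
    ℤ.+ + 3 ℤ.* phaseNum h (+ 3 ℤ.* M) (e ℤ.* + 2) ℤ.- + 9 ℤ.* phaseNum h M (e ℤ.* + 2)
  ℤ.- + 2 ℤ.* (ℤ.- (+ 9) ℤ.* (+ 3 ℤ.* M) ℤ.+ + 9 ℤ.* (+ 3 ℤ.* M) ℤ.* (+ 3 ℤ.* M)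
              ℤ.+ h ℤ.* (ℤ.- (+ 9) ℤ.+ + 5 ℤ.* (+ 3 ℤ.* M) ℤ.* (+ 3 ℤ.* M))
              ℤ.- + 2 ℤ.* (+ 3 ℤ.* M) ℤ.* (+ 3 ℤ.* M) ℤ.* (e ℤ.* + 2))
  ≡ + 2 ℤ.* (h ℤ.* q ℤ.* (+ 10 ℤ.* T ℤ.+ ℤ.1ℤ)) ℤ.* (+ 108 ℤ.* M)
phaseNum-identity₁ h e q M T M²-1≡8T hh′+1≡3qM = begin
  _ ≡⟨ solve (h ∷ e ∷ M ∷ []) ⟩
  + 18 ℤ.* h ℤ.* (+ 5 ℤ.* (M ℤ.* M ℤ.- ℤ.1ℤ) ℤ.+ + 4) ℤ.* (h ℤ.* (e ℤ.* + 2) ℤ.+ ℤ.1ℤ)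
    ≡⟨ cong₂ (λ u v → + 18 ℤ.* h ℤ.* (+ 5 ℤ.* u ℤ.+ + 4) ℤ.* v) M²-1≡8T hh′+1≡3qM ⟩
  + 18 ℤ.* h ℤ.* (+ 5 ℤ.* (T ℤ.* + 8) ℤ.+ + 4) ℤ.* (q ℤ.* (+ 3 ℤ.* M))
    ≡⟨ solve (h ∷ q ∷ M ∷ T ∷ []) ⟩
  + 2 ℤ.* (h ℤ.* q ℤ.* (+ 10 ℤ.* T ℤ.+ ℤ.1ℤ)) ℤ.* (+ 108 ℤ.* M) ∎
  where open ≡-Reasoning

phaseNum-identity₂ : ∀ h e q M T → M ℤ.* M ℤ.- ℤ.1ℤ ≡ T ℤ.* + 8 →
  h ℤ.* (e ℤ.* + 2) ℤ.+ ℤ.1ℤ ≡ q ℤ.* (+ 3 ℤ.* M) →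
  + 9 ℤ.* phaseNum h M (e ℤ.* + 2) ℤ.+ + 3 ℤ.* phaseNum (+ 2 ℤ.* h) (+ 3 ℤ.* M) e
    ℤ.+ + 3 ℤ.* phaseNum h (+ 3 ℤ.* M) (e ℤ.* + 2) ℤ.- + 9 ℤ.* (+ 3 ℤ.* phaseNum (+ 2 ℤ.* h) M e)
  ℤ.- + 4 ℤ.* (+ 3 ℤ.* (+ 3 ℤ.* M) ℤ.* (+ 3 ℤ.* M) ℤ.+ h ℤ.* (+ 9 ℤ.+ (+ 3 ℤ.* M) ℤ.* (+ 3 ℤ.* M))
              ℤ.- (+ 3 ℤ.* M) ℤ.* (+ 3 ℤ.* M) ℤ.* (e ℤ.* + 2))
  ≡ + 2 ℤ.* (h ℤ.* q ℤ.* (+ 4 ℤ.* T ℤ.+ ℤ.1ℤ)) ℤ.* (+ 108 ℤ.* M)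
phaseNum-identity₂ h e q M T M²-1≡8T hh′+1≡3qM = begin
  _ ≡⟨ solve (h ∷ e ∷ M ∷ []) ⟩
  + 36 ℤ.* h ℤ.* ((M ℤ.* M ℤ.- ℤ.1ℤ) ℤ.+ + 2) ℤ.* (h ℤ.* (e ℤ.* + 2) ℤ.+ ℤ.1ℤ)
    ≡⟨ cong₂ (λ u v → + 36 ℤ.* h ℤ.* (u ℤ.+ + 2) ℤ.* v) M²-1≡8T hh′+1≡3qM ⟩
  + 36 ℤ.* h ℤ.* (T ℤ.* + 8 ℤ.+ + 2) ℤ.* (q ℤ.* (+ 3 ℤ.* M))
    ≡⟨ solve (h ∷ q ∷ M ∷ T ∷ []) ⟩
  + 2 ℤ.* (h ℤ.* q ℤ.* (+ 4 ℤ.* T ℤ.+ ℤ.1ℤ)) ℤ.* (+ 108 ℤ.* M) ∎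
  where open ≡-Reasoning

phase-identity₁ : ∀ {m k} h e {h′ q} → 3 ℕ.* m ≡ k → ¬ 2 ℕD.∣ m → h′ ≡ e ℤ.* + 2 →
  h ℤ.* h′ ℤ.+ ℤ.1ℤ ≡ q ℤ.* + k →
  phase (+ 2 ℤ.* h) m e Q.+ phase (+ 2 ℤ.* h) k e Q.+ phase h k h′ Q.- phase h m h′ ≋
  mkℚᵘ (ℤ.- (+ 9) ℤ.* + k ℤ.+ + 9 ℤ.* + k ℤ.* + k ℤ.+ h ℤ.* (ℤ.- (+ 9) ℤ.+ + 5 ℤ.* + k ℤ.* + k)
        ℤ.- + 2 ℤ.* + k ℤ.* + k ℤ.* h′) (18 ℕ.* k ∸ 1)
phase-identity₁ {zero} _ _ _ 2∤0 _ _ = ⊥-elim (2∤0 (2 ℕD.∣0))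
phase-identity₁ {suc n} h e {q = q} refl 2∤m refl hh′+1≡qk with odd⇒8∣n²-1 2∤m
... | S.divides T M²-1≡8T = ≐⇒≋ (h ℤ.* q ℤ.* (+ 10 ℤ.* T ℤ.+ ℤ.1ℤ)) lhs rhs
  (phaseNum-identity₁ h e q M T M²-1≡8T (trans hh′+1≡qk (cong (q ℤ.*_) 3M)))
  where
  M = + suc n
  h′ = e ℤ.* + 2
  3M : + (3 ℕ.* suc n) ≡ + 3 ℤ.* M
  3M = ℤP.pos-* 3 (suc n)
  N : ℤ → ℤ
  N K = ℤ.- (+ 9) ℤ.* K ℤ.+ + 9 ℤ.* K ℤ.* K ℤ.+ h ℤ.* (ℤ.- (+ 9) ℤ.+ + 5 ℤ.* K ℤ.* K)
        ℤ.- + 2 ℤ.* K ℤ.* K ℤ.* h′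
  9·12M : ∀ M → + 9 ℤ.* (+ 12 ℤ.* M) ≡ + 108 ℤ.* M
  9·12M = solve-∀
  3·36M : ∀ M → + 3 ℤ.* (+ 12 ℤ.* (+ 3 ℤ.* M)) ≡ + 108 ℤ.* M
  3·36M = solve-∀
  2·54M : ∀ M → + 2 ℤ.* (+ 18 ℤ.* (+ 3 ℤ.* M)) ≡ + 108 ℤ.* M
  2·54M = solve-∀
  lhs = ≐-- (≐-+ (≐-+ (≐-scale (+ 9) (9·12M M) (phase-≐ (+ 2 ℤ.* h) n e))
                       (≐-scale (+ 3) (3·36M M) (phase-≐-3* (+ 2 ℤ.* h) n e)))
                 (≐-scale (+ 3) (3·36M M) (phase-≐-3* h n h′)))
            (≐-scale (+ 9) (9·12M M) (phase-≐ h n h′))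
  rhs-raw : mkℚᵘ (N (+ (3 ℕ.* suc n))) (18 ℕ.* (3 ℕ.* suc n) ∸ 1) ≐ N (+ 3 ℤ.* M) / + 18 ℤ.* (+ 3 ℤ.* M)
  rhs-raw = ≐-cong (cong N 3M) (trans (ℤP.pos-* 18 (3 ℕ.* suc n)) (cong (+ 18 ℤ.*_) 3M)) (≐-mkℚᵘ _ _)
  rhs = ≐-scale (+ 2) (2·54M M) rhs-raw

phase-identity₂ : ∀ {m k} h e {h′ q} → 3 ℕ.* m ≡ k → ¬ 2 ℕD.∣ m → h′ ≡ e ℤ.* + 2 →
  h ℤ.* h′ ℤ.+ ℤ.1ℤ ≡ q ℤ.* + k →
  phase h m h′ Q.+ phase (+ 2 ℤ.* h) k e Q.+ phase h k h′ Q.- ℤ→ℚ (+ 3) Q.* phase (+ 2 ℤ.* h) m e ≋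
  mkℚᵘ (+ 3 ℤ.* + k ℤ.* + k ℤ.+ h ℤ.* (+ 9 ℤ.+ + k ℤ.* + k) ℤ.- + k ℤ.* + k ℤ.* h′) (9 ℕ.* k ∸ 1)
phase-identity₂ {zero} _ _ _ 2∤0 _ _ = ⊥-elim (2∤0 (2 ℕD.∣0))
phase-identity₂ {suc n} h e {q = q} refl 2∤m refl hh′+1≡qk with odd⇒8∣n²-1 2∤m
... | S.divides T M²-1≡8T = ≐⇒≋ (h ℤ.* q ℤ.* (+ 4 ℤ.* T ℤ.+ ℤ.1ℤ)) lhs rhs
  (phaseNum-identity₂ h e q M T M²-1≡8T (trans hh′+1≡qk (cong (q ℤ.*_) 3M)))
  where
  M = + suc n
  h′ = e ℤ.* + 2
  3M : + (3 ℕ.* suc n) ≡ + 3 ℤ.* M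
  3M = ℤP.pos-* 3 (suc n)
  N : ℤ → ℤ
  N K = + 3 ℤ.* K ℤ.* K ℤ.+ h ℤ.* (+ 9 ℤ.+ K ℤ.* K) ℤ.- K ℤ.* K ℤ.* h′
  9·12M : ∀ M → + 9 ℤ.* (+ 12 ℤ.* M) ≡ + 108 ℤ.* M
  9·12M = solve-∀
  9·1·12M : ∀ M → + 9 ℤ.* (+ 1 ℤ.* (+ 12 ℤ.* M)) ≡ + 108 ℤ.* M
  9·1·12M = solve-∀
  3·36M : ∀ M → + 3 ℤ.* (+ 12 ℤ.* (+ 3 ℤ.* M)) ≡ + 108 ℤ.* M
  3·36M = solve-∀
  4·27M : ∀ M → + 4 ℤ.* (+ 9 ℤ.* (+ 3 ℤ.* M)) ≡ + 108 ℤ.* M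
  4·27M = solve-∀
  lhs = ≐-- (≐-+ (≐-+ (≐-scale (+ 9) (9·12M M) (phase-≐ h n h′))
                       (≐-scale (+ 3) (3·36M M) (phase-≐-3* (+ 2 ℤ.* h) n e)))
                 (≐-scale (+ 3) (3·36M M) (phase-≐-3* h n h′)))
            (≐-scale (+ 9) (9·1·12M M) (≐-* (≐-mkℚᵘ (+ 3) 0) (phase-≐ (+ 2 ℤ.* h) n e)))
  rhs-raw : mkℚᵘ (N (+ (3 ℕ.* suc n))) (9 ℕ.* (3 ℕ.* suc n) ∸ 1) ≐ N (+ 3 ℤ.* M) / + 9 ℤ.* (+ 3 ℤ.* M)
  rhs-raw = ≐-cong (cong N 3M) (trans (ℤP.pos-* 9 (3 ℕ.* suc n)) (cong (+ 9 ℤ.*_) 3M)) (≐-mkℚᵘ _ _)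
  rhs = ≐-scale (+ 4) (4·27M M) rhs-raw

regroup₁ : ∀ sa φa sb φb sc φc sd φd →
  (sa Q.- φa) Q.+ (sb Q.- φb) Q.+ (sc Q.- φc) Q.- (sd Q.- φd) ≃
  (sa Q.+ sb Q.+ sc Q.- sd) Q.- (φa Q.+ φb Q.+ φc Q.- φd)
regroup₁ = ℚSolver.solve-∀ ℚᵘ-ring

regroup₂ : ∀ c sa φa sb φb sc φc sd φd →
  (sd Q.- φd) Q.+ (sb Q.- φb) Q.+ (sc Q.- φc) Q.- c Q.* (sa Q.- φa) ≃
  (sd Q.+ sb Q.+ sc Q.- c Q.* sa) Q.- (φd Q.+ φb Q.+ φc Q.- c Q.* φa)
regroup₂ = ℚSolver.solve-∀ ℚᵘ-ring

lemma3p5 : (k : ℕ) → gcd k 6 ≡ 3 →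
  (h : ℤ) → Coprime h (+ k) →
  (h′ : ℤ) → (+ k) ∣ (h ℤ.* h′ ℤ.+ ℤ.1ℤ) → (+ 2) ∣ h′ →
  (a b c d : ℤ) →
  IsStar (+ 2 ℤ.* h) (k / 3) a →
  IsStar (+ 2 ℤ.* h) k b →
  IsStar h k c →
  IsStar h (k / 3) d →
  ((omegaExp (+ 2 ℤ.* h) (k / 3) a Q.+ omegaExp (+ 2 ℤ.* h) k b
      Q.+ omegaExp h k c Q.- omegaExp h (k / 3) d)
    ≈π (ℤ→ℚ ℤ.1ℤ Q.- mkℚᵘ
          (ℤ.- (+ 9) ℤ.* + k ℤ.+ + 9 ℤ.* + k ℤ.* + k
            ℤ.+ h ℤ.* (ℤ.- (+ 9) ℤ.+ + 5 ℤ.* + k ℤ.* + k)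
            ℤ.- + 2 ℤ.* + k ℤ.* + k ℤ.* h′)
          (18 ℕ.* k ∸ 1)))
  ×
  ((omegaExp h (k / 3) d Q.+ omegaExp (+ 2 ℤ.* h) k b
      Q.+ omegaExp h k c Q.- ℤ→ℚ (+ 3) Q.* omegaExp (+ 2 ℤ.* h) (k / 3) a)
    ≈π (ℤ→ℚ ℤ.1ℤ Q.- mkℚᵘ
          (+ 3 ℤ.* + k ℤ.* + k
            ℤ.+ h ℤ.* (+ 9 ℤ.+ + k ℤ.* + k)
            ℤ.- + k ℤ.* + k ℤ.* h′)
          (9 ℕ.* k ∸ 1)))
lemma3p5 k k⊓6≡3 h h⊥k h′ k∣hh′+1 2∣h′ a b c d a* b* c* d*
  with S.∣ᵤ⇒∣ {+ 2} {h′} 2∣h′ | S.∣ᵤ⇒∣ {+ k} {h ℤ.* h′ ℤ.+ ℤ.1ℤ} k∣hh′+1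
... | S.divides e h′≡e2 | S.divides q hh′+1≡qk =
    ≋⇒≈π (≋-trans (≋-- (≋-+ (≋-+ ωa ωb) ωc) ωd)
           (≋-trans (≃⇒≋ (regroup₁ sa φa sb φb sc φc sd φd))
             (≋-- (proj₁ signs) (phase-identity₁ h e {h′} {q} 3m≡k 2∤m h′≡e2 hh′+1≡qk))))
  , ≋⇒≈π (≋-trans (≋-- (≋-+ (≋-+ ωd ωb) ωc) (≋-*ˡ (+ 3) ωa))
           (≋-trans (≃⇒≋ (regroup₂ (ℤ→ℚ (+ 3)) sa φa sb φb sc φc sd φd))
             (≋-- (proj₂ signs) (phase-identity₂ h e {h′} {q} 3m≡k 2∤m h′≡e2 hh′+1≡qk))))
  where
  m = k / 3
  3m≡k = ℕDM.m*[n/m]≡n (gcd[n,6]≡3⇒3∣n k⊓6≡3)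
  2∤k = gcd[n,6]≡3⇒2∤n k⊓6≡3
  m∣k = ℕD.divides 3 (sym 3m≡k)
  2∤m : ¬ 2 ℕD.∣ m
  2∤m 2∣m = 2∤k (ℕD.∣-trans 2∣m m∣k)
  h⊥m = Coprime-∣ {h} m∣k h⊥k
  e* : IsStar (+ 2 ℤ.* h) k e
  e* = IsStar-2* h e (subst (IsStar h k) h′≡e2 k∣hh′+1)
  ωa = omegaExp-≋-phase 2∤m (Coprime-2* {h} {m} 2∤m h⊥m) a* (IsStar-∣ (+ 2 ℤ.* h) e m∣k e*)
  ωb = omegaExp-≋-phase 2∤k (Coprime-2* {h} {k} 2∤k h⊥k) b* e*
  ωc = omegaExp-≋-phase 2∤k h⊥k c* k∣hh′+1
  ωd = omegaExp-≋-phase 2∤m h⊥m d* (IsStar-∣ h h′ m∣k k∣hh′+1)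
  sa = signExp (kronecker (ℤ.- (+ 2 ℤ.* h)) (+ m))
  sb = signExp (kronecker (ℤ.- (+ 2 ℤ.* h)) (+ k))
  sc = signExp (kronecker (ℤ.- h) (+ k))
  sd = signExp (kronecker (ℤ.- h) (+ m))
  φa = phase (+ 2 ℤ.* h) m e
  φb = phase (+ 2 ℤ.* h) k e
  φc = phase h k h′
  φd = phase h m h′
  signs = kronecker-signExp-identities {m} h 3m≡k 2∤k h⊥k
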